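{- Let $F$ be a finite field with $|F|=q$, let $\omega$ be an arbitrary $k$th root of unity in $F$, let $n\ge 1$ and $R=M_n(F)$. Then for $1\le k\le n$, $$|\mathcal{I}_{k+1}(R)|\le (k+1)\,q^{\frac{2n^2k}{k+1}-1},$$ where $\mathcal{I}_{k+1}(R)=\{A\in R: A^{k+1}=A\}$ is the set of $(k+1)$-potent matrices.
   Context: $M_n(F)$ is the ring of $n\times n$ matrices over $F$. -}

module Defs where

open import Level using (Level; _⊔_) renaming (suc to lsuc)
open import Data.Nat using (ℕ; zero; suc)
open import Data.Fin using (Fin; zero; suc; _≟_)
open import Data.Product using (∃)
open import Relation.Nullary using (¬_; yes; no)
open import Relation.Binary.PropositionalEquality using (_≡_)
open import Algebra.Bundles using (CommutativeRing)

record FiniteField (c ℓ : Level) : Set (lsuc (c ⊔ ℓ)) where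
  field
    commRing : CommutativeRing c ℓ
  open CommutativeRing commRing public
  field
    1≉0      : ¬ (1# ≈ 0#)
    inverse  : ∀ x → ¬ (x ≈ 0#) → ∃ λ y → (x * y) ≈ 1#
    q        : ℕ
    toFin    : Carrier → Fin q
    fromFin  : Fin q → Carrier
    toFin-cong     : ∀ {x y} → x ≈ y → toFin x ≡ toFin y
    from∘to        : ∀ x → fromFin (toFin x) ≈ x
    to∘from        : ∀ i → toFin (fromFin i) ≡ i

module MatrixOps {c ℓ : Level} (F : FiniteField c ℓ) where
  open FiniteField F using (Carrier; _≈_; _+_; _*_; 0#; 1#)

  _^ᶠ_ : Carrier → ℕ → Carrier
  x ^ᶠ zero  = 1#
  x ^ᶠ suc m = x * (x ^ᶠ m)

  Matrix : ℕ → Set c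
  Matrix n = Fin n → Fin n → Carrier

  sumF : ∀ {n} → (Fin n → Carrier) → Carrier
  sumF {zero}  f = 0#
  sumF {suc n} f = f zero + sumF (λ i → f (suc i))

  _⊗_ : ∀ {n} → Matrix n → Matrix n → Matrix n
  (A ⊗ B) i j = sumF (λ l → A i l * B l j)

  I : ∀ {n} → Matrix n
  I i j with i ≟ j
  ... | yes _ = 1#
  ... | no  _ = 0#

  _^ᴹ_ : ∀ {n} → Matrix n → ℕ → Matrix n
  A ^ᴹ zero  = I
  A ^ᴹ suc m = A ⊗ (A ^ᴹ m)

  _≐_ : ∀ {n} → Matrix n → Matrix n → Set ℓ
  A ≐ B = ∀ i j → A i j ≈ B i j

  Potent : ∀ {n} → ℕ → Matrix n → Set ℓ
  Potent k A = (A ^ᴹ suc k) ≐ A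

-- For k ≥ 2 the trivial count |M_n(F)| ≤ q^(n²) already suffices, since
-- (n² + 1)(k + 1) ≤ 2n²k once 2 ≤ k ≤ n. For k = 1 we count idempotents
-- more sharply, by 2q^(n² - 1): if A² = A, its corner entry a satisfies
-- a² + c = a with c = Σ_{l>0} A_{0l} A_{l0} depending only on the off-corner
-- entries, so every idempotent with the same off-corner entries has corner
-- a or 1 - a, and one bit tells which.
module Submission where

open import Defs
open import Level using (Level)
open import Data.Empty using (⊥-elim)
open import Data.Fin using (Fin; zero; suc; combine; funToFin; finToFun; _≤?_)
open import Data.Fin.Properties
  using (finToFun-funToFin; combine-injective; ≤-antisym; ≤-total; injective⇒≤; nonZeroIndex)
  renaming (_≟_ to _≟ᶠ_)
open import Data.Nat as ℕ using (ℕ; NonZero)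
open import Data.Product using (_,_; proj₁; proj₂)
open import Data.Sum using (_⊎_; inj₁; inj₂; [_,_]′)
open import Function using (_∘_)
open import Relation.Nullary using (Dec; yes; no)
open import Relation.Nullary.Decidable using (map′)
open import Relation.Binary using (Decidable)
open import Relation.Binary.PropositionalEquality as ≡ using (_≡_; _≗_)

funToFin-injective : ∀ {m n} {f g : Fin m → Fin n} → funToFin f ≡ funToFin g → f ≗ g
funToFin-injective {f = f} {g} eq i = begin
  f i                      ≡⟨ finToFun-funToFin f i ⟨
  finToFun (funToFin f) i  ≡⟨ ≡.cong (λ t → finToFun t i) eq ⟩
  finToFun (funToFin g) i  ≡⟨ finToFun-funToFin g i ⟩
  g i                      ∎
  where open ≡.≡-Reasoning

decBit : ∀ {p} {P : Set p} → Dec P → Fin 2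
decBit (yes _) = zero
decBit (no _)  = suc zero

orderBit : ∀ {q} → Fin q → Fin q → Fin 2
orderBit a b = decBit (a ≤? b)

orderBit-symmetric⇒≡ : ∀ {q} (a b : Fin q) → orderBit a b ≡ orderBit b a → a ≡ b
orderBit-symmetric⇒≡ a b eq with a ≤? b | b ≤? a
... | yes a≤b | yes b≤a = ≤-antisym a≤b b≤a
... | no a≰b  | no b≰a  = ⊥-elim ([ a≰b , b≰a ]′ (≤-total a b))

module FieldProperties {c ℓ : Level} (F : FiniteField c ℓ) where

  open FiniteField F hiding (zero)
  open MatrixOps F
  open import Algebra.Properties.Group +-group using (x∙y⁻¹≈ε⇒x≈y; \\-leftDividesʳ)
  open import Algebra.Properties.AbelianGroup +-abelianGroup using (⁻¹-∙-comm)
  open import Algebra.Properties.CommutativeSemigroup +-commutativeSemigroup using (interchange)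
  open import Algebra.Properties.Ring ring using (x[y-z]≈xy-xz; [y-z]x≈yx-zx)
  open import Relation.Binary.Reasoning.Setoid setoid

  toFin-injective : ∀ {x y} → toFin x ≡ toFin y → x ≈ y
  toFin-injective {x} {y} eq = begin
    x                  ≈⟨ from∘to x ⟨
    fromFin (toFin x)  ≡⟨ ≡.cong fromFin eq ⟩
    fromFin (toFin y)  ≈⟨ from∘to y ⟩
    y                  ∎

  _≈?_ : Decidable _≈_
  x ≈? y = map′ toFin-injective toFin-cong (toFin x ≟ᶠ toFin y)

  x*y≈0⇒x≈0⊎y≈0 : ∀ x y → x * y ≈ 0# → x ≈ 0# ⊎ y ≈ 0#
  x*y≈0⇒x≈0⊎y≈0 x y xy≈0 with x ≈? 0#
  ... | yes x≈0 = inj₁ x≈0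
  ... | no x≉0  with inverse x x≉0
  ... | x⁻¹ , xx⁻¹≈1 = inj₂ (begin
    y              ≈⟨ *-identityˡ y ⟨
    1# * y         ≈⟨ *-congʳ (trans (sym xx⁻¹≈1) (*-comm x x⁻¹)) ⟩
    (x⁻¹ * x) * y  ≈⟨ *-assoc x⁻¹ x y ⟩
    x⁻¹ * (x * y)  ≈⟨ *-congˡ xy≈0 ⟩
    x⁻¹ * 0#       ≈⟨ zeroʳ x⁻¹ ⟩
    0#             ∎)

  [u+w]-[v+w]≈u-v : ∀ u v w → (u + w) - (v + w) ≈ u - v
  [u+w]-[v+w]≈u-v u v w = begin
    (u + w) - (v + w)    ≈⟨ +-congˡ (⁻¹-∙-comm v w) ⟨
    (u + w) + (- v - w)  ≈⟨ interchange u w (- v) (- w) ⟩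
    (u - v) + (w - w)    ≈⟨ +-congˡ (-‿inverseʳ w) ⟩
    (u - v) + 0#         ≈⟨ +-identityʳ (u - v) ⟩
    u - v                ∎

  [x-y]+[y-z]≈x-z : ∀ x y z → (x - y) + (y - z) ≈ x - z
  [x-y]+[y-z]≈x-z x y z = begin
    (x - y) + (y - z)    ≈⟨ +-assoc x (- y) (y - z) ⟩
    x + (- y + (y - z))  ≈⟨ +-congˡ (\\-leftDividesʳ y (- z)) ⟩
    x - z                ∎

  [x-y]*[x+y]≈x*x-y*y : ∀ x y → (x - y) * (x + y) ≈ x * x - y * y
  [x-y]*[x+y]≈x*x-y*y x y = begin
    (x - y) * (x + y)                  ≈⟨ distribˡ (x - y) x y ⟩
    (x - y) * x + (x - y) * y          ≈⟨ +-cong ([y-z]x≈yx-zx x x y) ([y-z]x≈yx-zx y x y) ⟩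
    (x * x - y * x) + (x * y - y * y)  ≈⟨ +-congʳ (+-congˡ (-‿cong (*-comm y x))) ⟩
    (x * x - x * y) + (x * y - y * y)  ≈⟨ [x-y]+[y-z]≈x-z (x * x) (x * y) (y * y) ⟩
    x * x - y * y                      ∎

  x+y≈1⇒y≈1-x : ∀ {x y} → x + y ≈ 1# → y ≈ 1# - x
  x+y≈1⇒y≈1-x {x} {y} x+y≈1 = begin
    y              ≈⟨ \\-leftDividesʳ x y ⟨
    - x + (x + y)  ≈⟨ +-congˡ x+y≈1 ⟩
    - x + 1#       ≈⟨ +-comm (- x) 1# ⟩
    1# - x         ∎

  1-[1-x]≈x : ∀ x → 1# - (1# - x) ≈ x
  1-[1-x]≈x x = sym (x+y≈1⇒y≈1-x (begin
    (1# - x) + x    ≈⟨ +-assoc 1# (- x) x ⟩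
    1# + (- x + x)  ≈⟨ +-congˡ (-‿inverseˡ x) ⟩
    1# + 0#         ≈⟨ +-identityʳ 1# ⟩
    1#              ∎))

  -- (x - y)(x + y - 1) = (x² - x) - (y² - y), and both x² - x and y² - y equal -c.
  x*x+c≈x⇒y*y+c≈y⇒y≈x⊎y≈1-x : ∀ {x y c} → x * x + c ≈ x → y * y + c ≈ y →
                                y ≈ x ⊎ y ≈ 1# - x
  x*x+c≈x⇒y*y+c≈y⇒y≈x⊎y≈1-x {x} {y} {c} hx hy
    with x*y≈0⇒x≈0⊎y≈0 (x - y) ((x + y) - 1#) product≈0
    where
    product≈0 : (x - y) * ((x + y) - 1#) ≈ 0#
    product≈0 = begin
      (x - y) * ((x + y) - 1#)                ≈⟨ x[y-z]≈xy-xz (x - y) (x + y) 1# ⟩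
      (x - y) * (x + y) - (x - y) * 1#        ≈⟨ +-cong ([x-y]*[x+y]≈x*x-y*y x y)
                                                        (-‿cong (*-identityʳ (x - y))) ⟩
      (x * x - y * y) - (x - y)               ≈⟨ +-congʳ ([u+w]-[v+w]≈u-v (x * x) (y * y) c) ⟨
      ((x * x + c) - (y * y + c)) - (x - y)   ≈⟨ +-congʳ (+-cong hx (-‿cong hy)) ⟩
      (x - y) - (x - y)                       ≈⟨ -‿inverseʳ (x - y) ⟩
      0#                                      ∎
  ... | inj₁ x-y≈0   = inj₁ (sym (x∙y⁻¹≈ε⇒x≈y x y x-y≈0))
  ... | inj₂ x+y-1≈0 = inj₂ (x+y≈1⇒y≈1-x (x∙y⁻¹≈ε⇒x≈y (x + y) 1# x+y-1≈0))

  sumF-cong : ∀ {n} (f g : Fin n → Carrier) → (∀ i → f i ≈ g i) → sumF f ≈ sumF g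
  sumF-cong {ℕ.zero}  f g f≈g = refl
  sumF-cong {ℕ.suc n} f g f≈g = +-cong (f≈g zero) (sumF-cong (f ∘ suc) (g ∘ suc) (f≈g ∘ suc))

  sumF-*-zeroʳ : ∀ {n} (f : Fin n → Carrier) → sumF (λ i → f i * 0#) ≈ 0#
  sumF-*-zeroʳ {ℕ.zero}  f = refl
  sumF-*-zeroʳ {ℕ.suc n} f = trans (+-cong (zeroʳ (f zero)) (sumF-*-zeroʳ (f ∘ suc))) (+-identityʳ 0#)

  ⊗-identityʳ-column₀ : ∀ {n} (A : Matrix (ℕ.suc n)) i → (A ⊗ I) i zero ≈ A i zero
  -- I zero zero and I (suc l) zero compute to 1# and 0#.
  ⊗-identityʳ-column₀ A i = begin
    A i zero * 1# + sumF (λ l → A i (suc l) * 0#)  ≈⟨ +-cong (*-identityʳ (A i zero))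
                                                              (sumF-*-zeroʳ (A i ∘ suc)) ⟩
    A i zero + 0#                                  ≈⟨ +-identityʳ (A i zero) ⟩
    A i zero                                       ∎

  module _ {n} (A : Matrix (ℕ.suc n)) where

    corner : Carrier
    corner = A zero zero

    firstRow firstColumn : Fin n → Carrier
    firstRow j    = A zero (suc j)
    firstColumn i = A (suc i) zero

    minor : Matrix n
    minor i j = A (suc i) (suc j)

    borderProduct : Carrier
    borderProduct = sumF (λ l → firstRow l * firstColumn l)

    idempotent-corner : Potent 1 A → corner * corner + borderProduct ≈ corner
    -- The corner entry of A ⊗ A computes to corner * corner + borderProduct.
    idempotent-corner A²≈A = begin
      (A ⊗ A) zero zero        ≈⟨ sumF-cong (λ l → A zero l * A l zero)
                                            (λ l → A zero l * (A ⊗ I) l zero)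
                                            (λ l → *-congˡ (sym (⊗-identityʳ-column₀ A l))) ⟩
      (A ⊗ (A ⊗ I)) zero zero  ≈⟨ A²≈A zero zero ⟩
      corner                   ∎

  record SameOffCorner {n} (A B : Matrix (ℕ.suc n)) : Set ℓ where
    field
      firstRow≈    : ∀ j → firstRow A j ≈ firstRow B j
      firstColumn≈ : ∀ i → firstColumn A i ≈ firstColumn B i
      minor≐       : minor A ≐ minor B

  module _ {n} {A B : Matrix (ℕ.suc n)} (same : SameOffCorner A B) where
    open SameOffCorner same

    borderProduct-cong : borderProduct A ≈ borderProduct B
    borderProduct-cong = sumF-cong _ _ (λ l → *-cong (firstRow≈ l) (firstColumn≈ l))

    ≐-fromCorner : corner A ≈ corner B → A ≐ B
    ≐-fromCorner corner≈ zero    zero    = corner≈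
    ≐-fromCorner corner≈ zero    (suc j) = firstRow≈ j
    ≐-fromCorner corner≈ (suc i) zero    = firstColumn≈ i
    ≐-fromCorner corner≈ (suc i) (suc j) = minor≐ i j

  -- Tells the two roots x and 1 - x of t² - t + c apart.
  orientation : Carrier → Fin 2
  orientation x = orderBit (toFin x) (toFin (1# - x))

  orientation-≡⇒≈ : ∀ {x y} → y ≈ 1# - x → orientation x ≡ orientation y → y ≈ x
  orientation-≡⇒≈ {x} {y} y≈1-x eq = trans y≈1-x (sym (toFin-injective x≡1-x))
    where
    1-y≈x : 1# - y ≈ x
    1-y≈x = trans (+-congˡ (-‿cong y≈1-x)) (1-[1-x]≈x x)
    x≡1-x : toFin x ≡ toFin (1# - x)
    x≡1-x = orderBit-symmetric⇒≡ (toFin x) (toFin (1# - x))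
              (≡.trans eq (≡.cong₂ orderBit (toFin-cong y≈1-x) (toFin-cong 1-y≈x)))

  idempotents-sameOffCorner⇒≐ : ∀ {n} {A B : Matrix (ℕ.suc n)} → Potent 1 A → Potent 1 B →
                                SameOffCorner A B →
                                orientation (corner A) ≡ orientation (corner B) → A ≐ B
  idempotents-sameOffCorner⇒≐ {A = A} {B} A²≈A B²≈B same orientation≡ =
    ≐-fromCorner same corner≈
    where
    cornerB-root : corner B * corner B + borderProduct A ≈ corner B
    cornerB-root = trans (+-congˡ (borderProduct-cong same)) (idempotent-corner B B²≈B)

    corner≈ : corner A ≈ corner B
    corner≈ with x*x+c≈x⇒y*y+c≈y⇒y≈x⊎y≈1-x (idempotent-corner A A²≈A) cornerB-root
    ... | inj₁ b≈a   = sym b≈a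
    ... | inj₂ b≈1-a = sym (orientation-≡⇒≈ b≈1-a orientation≡)

  encodeVector : ∀ {n} → (Fin n → Carrier) → Fin (q ℕ.^ n)
  encodeVector v = funToFin (toFin ∘ v)

  encodeVector-injective : ∀ {n} {u v : Fin n → Carrier} → encodeVector u ≡ encodeVector v →
                           ∀ i → u i ≈ v i
  encodeVector-injective eq i = toFin-injective (funToFin-injective eq i)

  encodeMatrix : ∀ {n} → Matrix n → Fin ((q ℕ.^ n) ℕ.^ n)
  encodeMatrix A = funToFin (encodeVector ∘ A)

  encodeMatrix-injective : ∀ {n} {A B : Matrix n} → encodeMatrix A ≡ encodeMatrix B → A ≐ B
  encodeMatrix-injective eq i = encodeVector-injective (funToFin-injective eq i)

  encodeOffCorner : ∀ {n} → Matrix (ℕ.suc n) →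
                    Fin (q ℕ.^ n ℕ.* (q ℕ.^ n ℕ.* (q ℕ.^ n) ℕ.^ n))
  encodeOffCorner A =
    combine (encodeVector (firstRow A)) (combine (encodeVector (firstColumn A)) (encodeMatrix (minor A)))

  encodeOffCorner-injective : ∀ {n} {A B : Matrix (ℕ.suc n)} →
                              encodeOffCorner A ≡ encodeOffCorner B → SameOffCorner A B
  encodeOffCorner-injective {A = A} {B} eq
    with row≡ , rest≡ ←
           combine-injective (encodeVector (firstRow A)) _ (encodeVector (firstRow B)) _ eq
    with column≡ , minor≡ ←
           combine-injective (encodeVector (firstColumn A)) _ (encodeVector (firstColumn B)) _ rest≡
    = record
      { firstRow≈    = encodeVector-injective row≡
      ; firstColumn≈ = encodeVector-injective column≡
      ; minor≐       = encodeMatrix-injective minor≡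
      }

  encodeIdempotent : ∀ {n} → Matrix (ℕ.suc n) →
                     Fin (2 ℕ.* (q ℕ.^ n ℕ.* (q ℕ.^ n ℕ.* (q ℕ.^ n) ℕ.^ n)))
  encodeIdempotent A = combine (orientation (corner A)) (encodeOffCorner A)

  encodeIdempotent-injective : ∀ {n} {A B : Matrix (ℕ.suc n)} → Potent 1 A → Potent 1 B →
                               encodeIdempotent A ≡ encodeIdempotent B → A ≐ B
  encodeIdempotent-injective A²≈A B²≈B eq
    with orientation≡ , offCorner≡ ← combine-injective _ _ _ _ eq
    = idempotents-sameOffCorner⇒≐ A²≈A B²≈B (encodeOffCorner-injective offCorner≡) orientation≡

open import Data.Nat using (zero; suc; _+_; _*_; _^_; _≤_; z≤n; s≤s)
open import Data.Nat.Properties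
open import Data.Nat.Tactic.RingSolver using (solve-∀)

^-distribʳ-* : ∀ m n o → (m * n) ^ o ≡ m ^ o * n ^ o
^-distribʳ-* m n zero    = ≡.refl
^-distribʳ-* m n (suc o) = begin
  m * n * (m * n) ^ o        ≡⟨ ≡.cong (m * n *_) (^-distribʳ-* m n o) ⟩
  m * n * (m ^ o * n ^ o)    ≡⟨ *-assoc m n (m ^ o * n ^ o) ⟩
  m * (n * (m ^ o * n ^ o))  ≡⟨ ≡.cong (m *_) (x∙yz≈y∙xz n (m ^ o) (n ^ o)) ⟩
  m * (m ^ o * (n * n ^ o))  ≡⟨ *-assoc m (m ^ o) (n * n ^ o) ⟨
  m * m ^ o * (n * n ^ o)    ∎
  where
  open ≡.≡-Reasoning
  open import Algebra.Properties.CommutativeSemigroup *-commutativeSemigroup using (x∙yz≈y∙xz)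

m*q≤c*q^e⇒m^s*q^s≤c^s*q^[e*s] : ∀ m q c e s → m * q ≤ c * q ^ e →
                                m ^ s * q ^ s ≤ c ^ s * q ^ (e * s)
m*q≤c*q^e⇒m^s*q^s≤c^s*q^[e*s] m q c e s mq≤cqᵉ = begin
  m ^ s * q ^ s        ≡⟨ ^-distribʳ-* m q s ⟨
  (m * q) ^ s          ≤⟨ ^-monoˡ-≤ s mq≤cqᵉ ⟩
  (c * q ^ e) ^ s      ≡⟨ ^-distribʳ-* c (q ^ e) s ⟩
  c ^ s * (q ^ e) ^ s  ≡⟨ ≡.cong (c ^ s *_) (^-*-assoc q e s) ⟩
  c ^ s * q ^ (e * s)  ∎
  where open ≤-Reasoning

[n*n+1]*[1+k]≤2*n*n*k : ∀ {n k} → 2 ≤ k → k ≤ n → (n * n + 1) * suc k ≤ 2 * n * n * k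
[n*n+1]*[1+k]≤2*n*n*k {n} {k} 2≤k k≤n = begin
  (n * n + 1) * suc k          ≡⟨ expand n k ⟩
  n * n * k + (n * n + suc k)  ≤⟨ +-monoʳ-≤ (n * n * k) (+-monoʳ-≤ (n * n) 1+k≤n*n) ⟩
  n * n * k + (n * n + n * n)  ≡⟨ ≡.cong (n * n * k +_) (twice (n * n)) ⟩
  n * n * k + n * n * 2        ≤⟨ +-monoʳ-≤ (n * n * k) (*-monoʳ-≤ (n * n) 2≤k) ⟩
  n * n * k + n * n * k        ≡⟨ collect n k ⟩
  2 * n * n * k                ∎
  where
  open ≤-Reasoning
  expand : ∀ n k → (n * n + 1) * suc k ≡ n * n * k + (n * n + suc k)
  expand = solve-∀
  twice : ∀ a → a + a ≡ a * 2
  twice = solve-∀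
  collect : ∀ n k → n * n * k + n * n * k ≡ 2 * n * n * k
  collect = solve-∀
  1+k≤n*n : suc k ≤ n * n
  1+k≤n*n = begin
    suc k  ≡⟨ +-comm 1 k ⟩
    k + 1  ≤⟨ +-monoʳ-≤ k (≤-trans (s≤s z≤n) 2≤k) ⟩
    k + k  ≡⟨ twice k ⟩
    k * 2  ≤⟨ *-monoʳ-≤ k 2≤k ⟩
    k * k  ≤⟨ *-mono-≤ k≤n k≤n ⟩
    n * n  ∎

module Counting {c ℓ : Level} (F : FiniteField c ℓ) where

  open FiniteField F using (q)
  open MatrixOps F using (Matrix; Potent; _≐_)
  open FieldProperties F
    using (encodeMatrix; encodeMatrix-injective; encodeIdempotent; encodeIdempotent-injective)
  open ≤-Reasoning

  matrices-bound : ∀ {n m} (f : Fin m → Matrix n) → (∀ i j → f i ≐ f j → i ≡ j) →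
                   m * q ≤ 1 * q ^ (n * n + 1)
  matrices-bound {n} {m} f f-injective = begin
    m * q                ≤⟨ *-monoˡ-≤ q (injective⇒≤ encode-injective) ⟩
    (q ^ n) ^ n * q      ≡⟨ ≡.cong (_* q) (^-*-assoc q n n) ⟩
    q ^ (n * n) * q      ≡⟨ ≡.cong (q ^ (n * n) *_) (*-identityʳ q) ⟨
    q ^ (n * n) * q ^ 1  ≡⟨ ^-distribˡ-+-* q (n * n) 1 ⟨
    q ^ (n * n + 1)      ≡⟨ *-identityˡ (q ^ (n * n + 1)) ⟨
    1 * q ^ (n * n + 1)  ∎
    where
    encode-injective : ∀ {i j} → encodeMatrix (f i) ≡ encodeMatrix (f j) → i ≡ j
    encode-injective {i} {j} eq = f-injective i j (encodeMatrix-injective eq)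

  idempotents-bound : ∀ {n m} (f : Fin m → Matrix (suc n)) → (∀ i → Potent 1 (f i)) →
                      (∀ i j → f i ≐ f j → i ≡ j) → m * q ≤ 2 * q ^ (suc n * suc n)
  idempotents-bound {n} {m} f idempotent f-injective = begin
    m * q                                    ≤⟨ *-monoˡ-≤ q (injective⇒≤ encode-injective) ⟩
    2 * (q ^ n * (q ^ n * (q ^ n) ^ n)) * q  ≡⟨ *-assoc 2 (q ^ n * (q ^ n * (q ^ n) ^ n)) q ⟩
    2 * (q ^ n * (q ^ n * (q ^ n) ^ n) * q)  ≡⟨ ≡.cong (2 *_) count ⟩
    2 * q ^ (suc n * suc n)                  ∎
    where
    encode-injective : ∀ {i j} → encodeIdempotent (f i) ≡ encodeIdempotent (f j) → i ≡ j
    encode-injective {i} {j} eq =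
      f-injective i j (encodeIdempotent-injective (idempotent i) (idempotent j) eq)
    count : q ^ n * (q ^ n * (q ^ n) ^ n) * q ≡ q ^ (suc n * suc n)
    count = begin-equality
      q ^ n * (q ^ n * (q ^ n) ^ n) * q  ≡⟨ ≡.cong (λ t → q ^ n * (q ^ n * t) * q) (^-*-assoc q n n) ⟩
      q ^ n * (q ^ n * q ^ (n * n)) * q  ≡⟨ ≡.cong (λ t → q ^ n * t * q) (^-distribˡ-+-* q n (n * n)) ⟨
      q ^ n * q ^ (n + n * n) * q        ≡⟨ ≡.cong (_* q) (^-distribˡ-+-* q n (n + n * n)) ⟨
      q ^ (n + (n + n * n)) * q          ≡⟨ *-comm (q ^ (n + (n + n * n))) q ⟩
      q ^ suc (n + (n + n * n))          ≡⟨ ≡.cong (q ^_) (square-suc n) ⟩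
      q ^ (suc n * suc n)                ∎
      where
      square-suc : ∀ n → suc (n + (n + n * n)) ≡ suc n * suc n
      square-suc = solve-∀

open Counting using (matrices-bound; idempotents-bound)

lemma1 : ∀ {c ℓ : Level} (F : FiniteField c ℓ) →
         (n k : ℕ) → 1 ≤ n → 1 ≤ k → k ≤ n →
         (ω : FiniteField.Carrier F) →
         FiniteField._≈_ F (MatrixOps._^ᶠ_ F ω k) (FiniteField.1# F) →
         (m : ℕ) (f : Fin m → MatrixOps.Matrix F n) →
         (∀ i → MatrixOps.Potent F k (f i)) →
         (∀ i j → MatrixOps._≐_ F (f i) (f j) → i ≡ j) →
         (m ^ suc k) * (FiniteField.q F ^ suc k)
           ≤ (suc k ^ suc k) * (FiniteField.q F ^ (2 * n * n * k))
lemma1 F zero _ ()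
lemma1 F (suc n) 1 _ _ _ _ _ m f idempotent injective = begin
  m ^ 2 * q ^ 2                        ≤⟨ m*q≤c*q^e⇒m^s*q^s≤c^s*q^[e*s] m q 2 (suc n * suc n) 2
                                            (idempotents-bound F f idempotent injective) ⟩
  2 ^ 2 * q ^ (suc n * suc n * 2)      ≡⟨ ≡.cong (λ e → 2 ^ 2 * q ^ e) (reorder (suc n)) ⟩
  2 ^ 2 * q ^ (2 * suc n * suc n * 1)  ∎
  where
  open ≤-Reasoning
  q : ℕ
  q = FiniteField.q F
  reorder : ∀ a → a * a * 2 ≡ 2 * a * a * 1
  reorder = solve-∀
lemma1 F n k@(suc (suc _)) _ _ k≤n _ _ m f _ injective = begin
  m ^ suc k * q ^ suc k                  ≤⟨ m*q≤c*q^e⇒m^s*q^s≤c^s*q^[e*s] m q 1 (n * n + 1) (suc k)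
                                              (matrices-bound F f injective) ⟩
  1 ^ suc k * q ^ ((n * n + 1) * suc k)  ≡⟨ ≡.cong (_* q ^ ((n * n + 1) * suc k)) (^-zeroˡ (suc k)) ⟩
  1 * q ^ ((n * n + 1) * suc k)          ≡⟨ *-identityˡ (q ^ ((n * n + 1) * suc k)) ⟩
  q ^ ((n * n + 1) * suc k)              ≤⟨ ^-monoʳ-≤ q ([n*n+1]*[1+k]≤2*n*n*k 2≤k k≤n) ⟩
  q ^ (2 * n * n * k)                    ≤⟨ m≤n*m _ (suc k ^ suc k) ⟩
  suc k ^ suc k * q ^ (2 * n * n * k)    ∎
  where
  open ≤-Reasoning
  q : ℕ
  q = FiniteField.q F
  2≤k : 2 ≤ k
  2≤k = s≤s (s≤s z≤n)
  instance
    q-nonZero : NonZero q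
    q-nonZero = nonZeroIndex (FiniteField.toFin F (FiniteField.0# F))
    power-nonZero : NonZero (suc k ^ suc k)
    power-nonZero = m^n≢0 (suc k) (suc k)
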